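{- Let $G=(A\cup B,E)$ be an instance of the strongly stable matching problem, let $(a,b)\in E$ with $a\in A$, $b\in B$, and let $G_{(a,b)}$ be the graph obtained by the construction described in the context. Let $M'$ be a strongly stable matching of $G_{(a,b)}$. If $M'\cup\{(a,b)\}$ is a strongly stable matching of $G$, then for every strongly stable matching $N$ of $G_{(a,b)}$ the matching $N\cup\{(a,b)\}$ is a strongly stable matching of $G$. If $M'\cup\{(a,b)\}$ is not a strongly stable matching of $G$, then no strongly stable matching of $G$ contains the edge $(a,b)$.
   Context: An instance of the strongly stable matching problem (SSMP) is a finite bipartite graph $G=(A\cup B,E)$ (vertices of $A$ are "men", of $B$ "women") in which every vertex $v$ has a preference list: its set of neighbours is partitioned into disjoint "ties" (possibly singletons) which are linearly ordered. For neighbours $x,y$ of $v$ write $x\succ_v y$ if $x$ lies in a strictly earlier tie than $y$, $x=_v y$ if they lie in the same tie, and $x\succeq_v y$ if $x\succ_v y$ or $x=_v y$. A matching is a set of pairwise vertex-disjoint edges; $M(v)$ denotes the partner of $v$ in $M$. An edge $e\in E\setminus M$ blocks $M$ if its endpoints can be labelled $x,y$ so that $x$ is unmatched in $M$ or $y\succ_x M(x)$, and $y$ is unmatched in $M$ or $x\succeq_y M(y)$. A matching is strongly stable if no edge blocks it. Construction of $G_{(a,b)}$: it has vertex set $A\cup B$ and edge set $E'\subseteq E$, with preference lists obtained from those of $G$ by deleting the removed edges. $E'$ is obtained from $E$ by removing: (1) the edge $(a,b)$; (2) every $(a',b)\in E$ with $a\succ_b a'$; (3) every $(a',b)\in E$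 with $a=_b a'$, and additionally every $(a',b'')\in E$ with $b\succ_{a'} b''$; (4) every $(a',b)\in E$ with $a'\succ_b a$, and additionally every $(a',b'')\in E$ with $b\succeq_{a'} b''$; (5) every $(a,b')\in E$ with $b\succ_a b'$; (6) every $(a,b')\in E$ with $b'=_a b$, and additionally every $(a'',b')\in E$ with $a\succ_{b'} a''$; (7) every $(a,b')\in E$ with $b'\succ_a b$, and additionally every $(a'',b')\in E$ with $a\succeq_{b'} a''$. (In $G_{(a,b)}$ the vertices $a$ and $b$ are isolated.) -}

module Defs where

open import Data.Nat using (ℕ; _<_; _≤_)
open import Data.Fin using (Fin)
open import Data.Product using (Σ; _×_; ∃; ∃-syntax)
open import Data.Sum using (_⊎_)
open import Relation.Nullary using (¬_)
open import Relation.Binary.PropositionalEquality using (_≡_)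

-- An SSMP instance with men A = Fin m and women B = Fin n.
-- edge a b    : (a , b) ∈ E.
-- rankA a b   : index of the tie of b in a's preference list (smaller = better);
-- rankB b a   : index of the tie of a in b's preference list.
-- Ranks are only meaningful for neighbours.  x ≻_v y  iff rank v x < rank v y,
-- x =_v y iff ranks are equal, x ⪰_v y iff rank v x ≤ rank v y.
record Instance (m n : ℕ) : Set₁ where
  field
    edge  : Fin m → Fin n → Set
    rankA : Fin m → Fin n → ℕ
    rankB : Fin n → Fin m → ℕ
open Instance public

EdgeSet : ℕ → ℕ → Set₁
EdgeSet m n = Fin m → Fin n → Set

module _ {m n : ℕ} (G : Instance m n) where

  record IsMatching (M : EdgeSet m n) : Set where
    field
      ⊆E     : ∀ a b → M a b → edge G a b
      uniqA  : ∀ a b b' → M a b → M a b' → b ≡ b'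
      uniqB  : ∀ a a' b → M a b → M a' b → a ≡ a'

  module _ (M : EdgeSet m n) where

    UnmatchedA : Fin m → Set
    UnmatchedA a = ∀ b → ¬ M a b

    UnmatchedB : Fin n → Set
    UnmatchedB b = ∀ a → ¬ M a b

    StrictA : Fin m → Fin n → Set
    StrictA a b = UnmatchedA a ⊎ (∃[ b' ] (M a b' × rankA G a b < rankA G a b'))

    WeakA : Fin m → Fin n → Set
    WeakA a b = UnmatchedA a ⊎ (∃[ b' ] (M a b' × rankA G a b ≤ rankA G a b'))

    StrictB : Fin n → Fin m → Set
    StrictB b a = UnmatchedB b ⊎ (∃[ a' ] (M a' b × rankB G b a < rankB G b a'))

    WeakB : Fin n → Fin m → Set
    WeakB b a = UnmatchedB b ⊎ (∃[ a' ] (M a' b × rankB G b a ≤ rankB G b a'))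

    Blocks : Fin m → Fin n → Set
    Blocks a b = edge G a b × ¬ M a b ×
                 ((StrictA a b × WeakB b a) ⊎ (StrictB b a × WeakA a b))

  record StronglyStable (M : EdgeSet m n) : Set where
    field
      matching : IsMatching M
      noBlock  : ∀ a b → ¬ Blocks M a b

_∪⟨_,_⟩ : {m n : ℕ} → EdgeSet m n → Fin m → Fin n → EdgeSet m n
(M ∪⟨ a , b ⟩) x y = M x y ⊎ (x ≡ a × y ≡ b)

-- The construction G_(a,b).  Removed G a b x y: edge (x , y) is removed by one of
-- the rules (1)-(7).
module _ {m n : ℕ} (G : Instance m n) (a : Fin m) (b : Fin n) where

  private
    rA = rankA G
    rB = rankB G

  data Removed (x : Fin m) (y : Fin n) : Set where
    r1  : x ≡ a → y ≡ b → Removed x y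
    r2  : y ≡ b → rB b a < rB b x → Removed x y
    r3  : y ≡ b → rB b x ≡ rB b a → Removed x y
    r3' : edge G x b → rB b x ≡ rB b a → rA x b < rA x y → Removed x y
    r4  : y ≡ b → rB b x < rB b a → Removed x y
    r4' : edge G x b → rB b x < rB b a → rA x b ≤ rA x y → Removed x y
    r5  : x ≡ a → rA a b < rA a y → Removed x y
    r6  : x ≡ a → rA a y ≡ rA a b → Removed x y
    r6' : edge G a y → rA a y ≡ rA a b → rB y a < rB y x → Removed x y
    r7  : x ≡ a → rA a y < rA a b → Removed x y
    r7' : edge G a y → rA a y < rA a b → rB y a ≤ rB y x → Removed x y

  G[_,_] : Instance m n
  G[_,_] = record
    { edge  = λ x y → edge G x y × ¬ Removed x y
    ; rankA = rA
    ; rankB = rB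
    }

module Submission where

-- Write G' = G_(a,b) and, for a matching N of G', U(N) = N ∪ {(a,b)}.
-- Two facts drive the argument.
--   * Rural hospitals: two strongly stable matchings of one instance leave the
--     same vertices unmatched.  A man matched in M but not in N starts an
--     alternating M/N path that stability forces to grow forever, while its men
--     stay pairwise distinct, contradicting the pigeonhole principle.  Matchings
--     are arbitrary predicates, so this runs in the double-negation monad.
--   * Call x a rival of a if x ≠ a, (x,b) ∈ E and x ⪰_b a (dually for b).  An edge
--     deleted by the construction can block U(N) only if a rival is unmatched in
--     N; an edge kept in G' blocks U(N) only if it blocks N in G'.
-- Part 1: if U(M') is strongly stable, no rival is unmatched in M', hence (rural
-- hospitals in G') none in N; so no edge blocks U(N).
-- Part 2: from a strongly stable N of G containing (a,b), deleting (a,b) yields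
-- a strongly stable matching K of G' with U(K) = N; Part 1 applied to K and M'
-- makes U(M') strongly stable.

open import Defs
open import Data.Nat using (ℕ; zero; suc; _<_; _≤_; _≤‴_; ≤‴-refl; ≤‴-step; z≤n; s≤s)
open import Data.Nat.Properties
  using (<⇒≤; <⇒≱; <-irrefl; <-trans; ≤-reflexive; <-≤-trans; ≤-trans; ≰⇒>; _≤?_;
         n<1+n; ≤-pred; ≤-antisym; ≤⇒≤‴; ≤‴⇒≤)
open import Data.Fin using (Fin; toℕ)
open import Data.Fin.Properties using (pigeonhole; toℕ<n; _≟_)
open import Data.Product using (_×_; ∃-syntax; _,_; proj₁; proj₂)
open import Data.Sum using (_⊎_; inj₁; inj₂)
open import Data.Empty using (⊥; ⊥-elim)
open import Function using (flip; _∘_)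
open import Relation.Nullary using (¬_; yes; no)
open import Relation.Nullary.Decidable using (¬¬-excluded-middle)
open import Relation.Binary.PropositionalEquality using (_≡_; _≢_; refl; sym; trans; subst; cong)

open StronglyStable
open IsMatching

Envy : {m n : ℕ} → Instance m n → EdgeSet m n → Fin m → Fin n → Set
Envy H M x y = (StrictA H M x y × WeakB H M y x) ⊎ (StrictB H M y x × WeakA H M x y)

-- "x is unmatched in M or ranks y ~ M(x)": StrictA is PrefA _<_, WeakA is PrefA _≤_.
PrefA : {m n : ℕ} → (ℕ → ℕ → Set) → Instance m n → EdgeSet m n → Fin m → Fin n → Set
PrefA _~_ H M x y = UnmatchedA H M x ⊎ ∃[ y' ] (M x y' × rankA H x y ~ rankA H x y')

-- Every notion for
-- women in H is definitionally the corresponding notion for men in H ᵀ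
-- (with flip M in place of M), so statements about men transfer to women.
_ᵀ : {m n : ℕ} → Instance m n → Instance n m
H ᵀ = record { edge = flip (edge H) ; rankA = rankB H ; rankB = rankA H }

transpose-matching : {m n : ℕ} {H : Instance m n} {M : EdgeSet m n} →
                     IsMatching H M → IsMatching (H ᵀ) (flip M)
transpose-matching μ = record
  { ⊆E = λ y x → ⊆E μ x y ; uniqA = λ y x x' → uniqB μ x x' y ; uniqB = λ y y' x → uniqA μ x y y' }

transpose-stable : {m n : ℕ} {H : Instance m n} {M : EdgeSet m n} →
                   StronglyStable H M → StronglyStable (H ᵀ) (flip M)
transpose-stable σ = record
  { matching = transpose-matching (matching σ)
  ; noBlock  = λ { y x (e , x∉M , inj₁ envy) → noBlock σ x y (e , x∉M , inj₂ envy)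
                 ; y x (e , x∉M , inj₂ envy) → noBlock σ x y (e , x∉M , inj₁ envy) } }

strict⇒weak : {m n : ℕ} {H : Instance m n} {M : EdgeSet m n} {x : Fin m} {y : Fin n} →
              StrictA H M x y → WeakA H M x y
strict⇒weak (inj₁ free)             = inj₁ free
strict⇒weak (inj₂ (y' , xy' , y≻y')) = inj₂ (y' , xy' , <⇒≤ y≻y')

strict⇒unmatched : {m n : ℕ} {H : Instance m n} {M : EdgeSet m n} {x : Fin m} {y : Fin n} →
                   IsMatching H M → StrictA H M x y → ¬ M x y
strict⇒unmatched μ (inj₁ free) xy = free _ xy
strict⇒unmatched {H = H} {x = x} μ (inj₂ (y' , xy' , y≻y')) xy =
  <-irrefl (cong (rankA H x) (uniqA μ x _ y' xy xy')) y≻y'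

-- If x does not weakly prefer y, then x has a partner he ranks strictly above y
-- (only double-negated: x being matched is a negated statement).
¬weak⇒better : {m n : ℕ} {H : Instance m n} {M : EdgeSet m n} {x : Fin m} {y : Fin n} →
               ¬ WeakA H M x y → ¬ ¬ (∃[ y' ] (M x y' × rankA H x y' < rankA H x y))
¬weak⇒better {H = H} {M} {x} {y} ¬weak better? =
  ¬weak (inj₁ λ y' xy' → better? (y' , xy' , better y' xy'))
  where
  better : ∀ y' → M x y' → rankA H x y' < rankA H x y
  better y' xy' with rankA H x y ≤? rankA H x y'
  ... | yes y⪰y' = ⊥-elim (¬weak (inj₂ (y' , xy' , y⪰y')))
  ... | no  y⋡y' = ≰⇒> y⋡y'

strictB⇒weak : {m n : ℕ} {H : Instance m n} {M : EdgeSet m n} {y : Fin n} {x : Fin m} →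
               StrictB H M y x → WeakB H M y x
strictB⇒weak {H = H} {M} {y} {x} = strict⇒weak {H = H ᵀ} {flip M} {y} {x}

strictB⇒unmatched : {m n : ℕ} {H : Instance m n} {M : EdgeSet m n} {y : Fin n} {x : Fin m} →
                    IsMatching H M → StrictB H M y x → ¬ M x y
strictB⇒unmatched {H = H} {M} {y} {x} μ =
  strict⇒unmatched {H = H ᵀ} {flip M} {y} {x} (transpose-matching μ)

¬weakB⇒better : {m n : ℕ} {H : Instance m n} {M : EdgeSet m n} {y : Fin n} {x : Fin m} →
                ¬ WeakB H M y x → ¬ ¬ (∃[ x' ] (M x' y × rankB H y x' < rankB H y x))
¬weakB⇒better {H = H} {M} {y} {x} = ¬weak⇒better {H = H ᵀ} {flip M} {y} {x}

record AgreeA {m n : ℕ} (M₁ M₂ : EdgeSet m n) (x : Fin m) : Set where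
  field
    to   : ∀ y → M₁ x y → M₂ x y
    from : ∀ y → M₂ x y → M₁ x y
open AgreeA

AgreeB : {m n : ℕ} → EdgeSet m n → EdgeSet m n → Fin n → Set
AgreeB M₁ M₂ y = AgreeA (flip M₁) (flip M₂) y

pref-transfer : {m n : ℕ} (_~_ : ℕ → ℕ → Set) {H : Instance m n} {M₁ M₂ : EdgeSet m n}
                {x : Fin m} {y : Fin n} →
                AgreeA M₁ M₂ x → PrefA _~_ H M₁ x y → PrefA _~_ H M₂ x y
pref-transfer _ agree (inj₁ free)             = inj₁ λ y' xy' → free y' (from agree y' xy')
pref-transfer _ agree (inj₂ (y' , xy' , cmp)) = inj₂ (y' , to agree y' xy' , cmp)

envy-transfer : {m n : ℕ} {H : Instance m n} {M₁ M₂ : EdgeSet m n} {x : Fin m} {y : Fin n} →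
                AgreeA M₁ M₂ x → AgreeB M₁ M₂ y → Envy H M₁ x y → Envy H M₂ x y
envy-transfer {H = H} agreeˣ agreeʸ (inj₁ (s , w)) =
  inj₁ (pref-transfer _<_ {H = H} agreeˣ s , pref-transfer _≤_ {H = H ᵀ} agreeʸ w)
envy-transfer {H = H} agreeˣ agreeʸ (inj₂ (s , w)) =
  inj₂ (pref-transfer _<_ {H = H ᵀ} agreeʸ s , pref-transfer _≤_ {H = H} agreeˣ w)

stable-resp : {m n : ℕ} {H : Instance m n} {M₁ M₂ : EdgeSet m n} →
              (∀ x y → M₁ x y → M₂ x y) → (∀ x y → M₂ x y → M₁ x y) →
              StronglyStable H M₁ → StronglyStable H M₂
stable-resp {H = H} {M₁} {M₂} M₁⊆M₂ M₂⊆M₁ σ = record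
  { matching = record
    { ⊆E    = λ x y → ⊆E (matching σ) x y ∘ M₂⊆M₁ x y
    ; uniqA = λ x y y' p q → uniqA (matching σ) x y y' (M₂⊆M₁ _ _ p) (M₂⊆M₁ _ _ q)
    ; uniqB = λ x x' y p q → uniqB (matching σ) x x' y (M₂⊆M₁ _ _ p) (M₂⊆M₁ _ _ q) }
  ; noBlock = λ x y (e , ∉M₂ , envy) →
      noBlock σ x y (e , ∉M₂ ∘ M₁⊆M₂ x y , envy-transfer {H = H} agreeA agreeB envy) }
  where
  agreeA : ∀ {x} → AgreeA M₂ M₁ x
  agreeA = record { to = λ y → M₂⊆M₁ _ y ; from = λ y → M₁⊆M₂ _ y }
  agreeB : ∀ {y} → AgreeB M₂ M₁ y
  agreeB = record { to = λ x → M₂⊆M₁ x _ ; from = λ x → M₁⊆M₂ x _ }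

module RuralHospitals {m n : ℕ} (H : Instance m n) {M N : EdgeSet m n}
                      (stableM : StronglyStable H M) (stableN : StronglyStable H N) where

  _◅_ : {A : Set} → A → (ℕ → A) → ℕ → A
  (x ◅ s) zero    = x
  (x ◅ s) (suc i) = s i

  -- An alternating path of length k, listed from its newest end: man k is
  -- unmatched in N, man i is M-matched to woman i and N-matched to woman (i+1),
  -- and man 0 strictly prefers his M-partner to his situation in N.
  record AlternatingPath (k : ℕ) : Set where
    field
      man         : ℕ → Fin m
      woman       : ℕ → Fin n
      origin-free : UnmatchedA H N (man k)
      inM         : ∀ i → i ≤ k → M (man i) (woman i)
      inN         : ∀ i → i < k → N (man i) (woman (suc i))
      envious     : StrictA H N (man 0) (woman 0)
  open AlternatingPath

  grow : ∀ {k} (p : AlternatingPath k) {x' : Fin m} {y' : Fin n} →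
         N x' (woman p 0) → M x' y' → rankA H x' y' < rankA H x' (woman p 0) →
         AlternatingPath (suc k)
  grow p {x'} {y'} x'y∈N x'y'∈M y'≻y = record
    { man = x' ◅ man p ; woman = y' ◅ woman p ; origin-free = origin-free p
    ; inM = inM' ; inN = inN' ; envious = inj₂ (woman p 0 , x'y∈N , y'≻y) }
    where
    inM' : ∀ i → i ≤ _ → M ((x' ◅ man p) i) ((y' ◅ woman p) i)
    inM' zero    _           = x'y'∈M
    inM' (suc i) (s≤s i≤k) = inM p i i≤k
    inN' : ∀ i → i < _ → N ((x' ◅ man p) i) ((y' ◅ woman p) (suc i))
    inN' zero    _           = x'y∈N
    inN' (suc i) (s≤s i<k) = inN p i i<k

  -- Stability forces the path to continue: woman 0 must have an N-partner x'
  -- she prefers to man 0 (else man 0 and woman 0 block N), and x' must have an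
  -- M-partner he prefers to woman 0 (else x' and woman 0 block M).
  extend : ∀ {k} → AlternatingPath k → ¬ ¬ AlternatingPath (suc k)
  extend p continue =
    ¬weakB⇒better {H = H} {N} y-not-weak λ (x' , x'y∈N , x'≻x) →
    ¬weak⇒better {H = H} {M} (x'-not-weak x'y∈N x'≻x) λ (y' , x'y'∈M , y'≻y) →
    continue (grow p x'y∈N x'y'∈M y'≻y)
    where
    x = man p 0
    y = woman p 0
    xy∈M = inM p 0 z≤n
    y-not-weak : ¬ WeakB H N y x
    y-not-weak weak = noBlock stableN x y
      (⊆E (matching stableM) x y xy∈M , strict⇒unmatched (matching stableN) (envious p) ,
       inj₁ (envious p , weak))
    x'-not-weak : ∀ {x'} → N x' y → rankB H y x' < rankB H y x → ¬ WeakA H M x' y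
    x'-not-weak {x'} x'y∈N x'≻x weak = noBlock stableM x' y
      (⊆E (matching stableN) x' y x'y∈N ,
       strictB⇒unmatched (matching stableM) y-envious ,
       inj₂ (y-envious , weak))
      where
      y-envious : StrictB H M y x'
      y-envious = inj₂ (x , xy∈M , x'≻x)

  -- The men on an alternating path are pairwise distinct: equal men at i < j
  -- would force equal men at i+1 < j+1, up to the N-unmatched origin.
  distinct : ∀ {k} (p : AlternatingPath k) {i j} → i < j → j ≤‴ k → man p i ≢ man p j
  distinct p {i} i<j ≤‴-refl same =
    origin-free p (woman p (suc i)) (subst (λ z → N z (woman p (suc i))) same (inN p i i<j))
  distinct {k} p {i} {j} i<j (≤‴-step j<‴k) same =
    distinct p (s≤s i<j) j<‴k next-same
    where
    j<k : j < k
    j<k = ≤‴⇒≤ j<‴k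
    same-woman : woman p (suc i) ≡ woman p (suc j)
    same-woman = uniqA (matching stableN) (man p j) _ _
      (subst (λ z → N z (woman p (suc i))) same (inN p i (<-trans i<j j<k))) (inN p j j<k)
    next-same : man p (suc i) ≡ man p (suc j)
    next-same = uniqB (matching stableM) _ _ (woman p (suc j))
      (subst (M (man p (suc i))) same-woman (inM p (suc i) (<-trans i<j j<k)))
      (inM p (suc j) j<k)

  -- A path of length m would contain m+1 distinct men.
  unmatched-preserved : ∀ x → UnmatchedA H N x → UnmatchedA H M x
  unmatched-preserved x x-free y xy∈M = paths m too-long
    where
    paths : ∀ k → ¬ ¬ AlternatingPath k
    paths zero    continue = continue record
      { man = λ _ → x ; woman = λ _ → y ; origin-free = x-free
      ; inM = λ _ _ → xy∈M ; inN = λ _ () ; envious = inj₁ x-free }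
    paths (suc k) continue = paths k λ p → extend p continue
    too-long : AlternatingPath m → ⊥
    too-long p with i , j , i<j , same ← pigeonhole (n<1+n m) (man p ∘ toℕ) =
      distinct p i<j (≤⇒≤‴ (≤-pred (toℕ<n j))) same

unmatchedA-preserved : {m n : ℕ} {H : Instance m n} {M N : EdgeSet m n} →
                       StronglyStable H M → StronglyStable H N →
                       ∀ x → UnmatchedA H N x → UnmatchedA H M x
unmatchedA-preserved {H = H} stableM stableN =
  RuralHospitals.unmatched-preserved H stableM stableN

unmatchedB-preserved : {m n : ℕ} {H : Instance m n} {M N : EdgeSet m n} →
                       StronglyStable H M → StronglyStable H N →
                       ∀ y → UnmatchedB H N y → UnmatchedB H M y
unmatchedB-preserved {H = H} stableM stableN =
  RuralHospitals.unmatched-preserved (H ᵀ) (transpose-stable stableM) (transpose-stable stableN)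

module Union {m n : ℕ} (G : Instance m n) (a : Fin m) (b : Fin n) (N : EdgeSet m n) where

  U : EdgeSet m n
  U = N ∪⟨ a , b ⟩

  union-agreesA : ∀ {x} → x ≢ a → AgreeA U N x
  union-agreesA x≢a = record
    { to = λ { _ (inj₁ xy) → xy ; _ (inj₂ (x≡a , _)) → ⊥-elim (x≢a x≡a) } ; from = λ _ → inj₁ }

  union-agreesB : ∀ {y} → y ≢ b → AgreeB U N y
  union-agreesB y≢b = record
    { to = λ { _ (inj₁ xy) → xy ; _ (inj₂ (_ , y≡b)) → ⊥-elim (y≢b y≡b) } ; from = λ _ → inj₁ }

  union-freeA : ∀ {x} → x ≢ a → UnmatchedA G N x → UnmatchedA G U x
  union-freeA x≢a free y = λ { (inj₁ xy) → free y xy ; (inj₂ (x≡a , _)) → x≢a x≡a }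

  union-freeB : ∀ {y} → y ≢ b → UnmatchedB G N y → UnmatchedB G U y
  union-freeB y≢b free x = λ { (inj₁ xy) → free x xy ; (inj₂ (_ , y≡b)) → y≢b y≡b }

  situationA : ∀ _~_ {x y} → PrefA _~_ G U x y →
               (x ≡ a × rankA G a y ~ rankA G a b) ⊎ (x ≢ a × UnmatchedA G N x) ⊎
               (∃[ y' ] (N x y' × rankA G x y ~ rankA G x y'))
  situationA _ (inj₁ free) = inj₂ (inj₁ ((λ { refl → free b (inj₂ (refl , refl)) }) ,
                                        λ y' xy' → free y' (inj₁ xy')))
  situationA _ (inj₂ (y' , inj₁ xy' , cmp))          = inj₂ (inj₂ (y' , xy' , cmp))
  situationA _ (inj₂ (_ , inj₂ (refl , refl) , cmp)) = inj₁ (refl , cmp)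

  situationB : ∀ _~_ {x y} → PrefA _~_ (G ᵀ) (flip U) y x →
               (y ≡ b × rankB G b x ~ rankB G b a) ⊎ (y ≢ b × UnmatchedB G N y) ⊎
               (∃[ x' ] (N x' y × rankB G y x ~ rankB G y x'))
  situationB _ (inj₁ free) = inj₂ (inj₁ ((λ { refl → free a (inj₂ (refl , refl)) }) ,
                                        λ x' x'y → free x' (inj₁ x'y)))
  situationB _ (inj₂ (x' , inj₁ x'y , cmp))          = inj₂ (inj₂ (x' , x'y , cmp))
  situationB _ (inj₂ (_ , inj₂ (refl , refl) , cmp)) = inj₁ (refl , cmp)

  weakA-of : ∀ {x y} → Envy G U x y → WeakA G U x y
  weakA-of (inj₁ (s , _)) = strict⇒weak {H = G} {U} s
  weakA-of (inj₂ (_ , w)) = w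

  weakB-of : ∀ {x y} → Envy G U x y → WeakB G U y x
  weakB-of (inj₁ (_ , w)) = w
  weakB-of (inj₂ (s , _)) = strictB⇒weak {H = G} {U} s

module Construction {m n : ℕ} (G : Instance m n) (a : Fin m) (b : Fin n) where

  G' : Instance m n
  G' = G[_,_] G a b

  private
    rA = rankA G
    rB = rankB G

  -- Every edge kept in G' avoids a and b: rules (5)-(7) delete all edges at a,
  -- rules (2)-(4) all edges at b.
  kept-avoids : ∀ {x y} → ¬ Removed G a b x y → x ≢ a × y ≢ b
  kept-avoids {x} {y} kept = avoid-a , avoid-b
    where
    avoid-a : x ≢ a
    avoid-a refl with rA a y ≤? rA a b | rA a b ≤? rA a y
    ... | yes y⪰b | yes b⪰y = kept (r6 refl (≤-antisym y⪰b b⪰y))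
    ... | yes y⪰b | no  b⋡y = kept (r7 refl (≰⇒> b⋡y))
    ... | no  y⋡b | _       = kept (r5 refl (≰⇒> y⋡b))
    avoid-b : y ≢ b
    avoid-b refl with rB b x ≤? rB b a | rB b a ≤? rB b x
    ... | yes x⪰a | yes a⪰x = kept (r3 refl (≤-antisym x⪰a a⪰x))
    ... | yes x⪰a | no  a⋡x = kept (r4 refl (≰⇒> a⋡x))
    ... | no  x⋡a | _       = kept (r2 refl (≰⇒> x⋡a))

  RivalA : Fin m → Set
  RivalA x = x ≢ a × edge G x b × rB b x ≤ rB b a

  RivalB : Fin n → Set
  RivalB y = y ≢ b × edge G a y × rA a y ≤ rA a b

  RivalUnmatched : EdgeSet m n → Set
  RivalUnmatched N = (∃[ x ] (RivalA x × UnmatchedA G' N x)) ⊎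
                     (∃[ y ] (RivalB y × UnmatchedB G' N y))

  -- If N ∪ {(a,b)} is strongly stable in G, every rival is matched in N:
  -- an unmatched rival would block it together with b (resp. a).
  rivals-matched : ∀ {N} → StronglyStable G (N ∪⟨ a , b ⟩) → ¬ RivalUnmatched N
  rivals-matched {N} σ (inj₁ (x , (x≢a , e , x⪰a) , free)) =
    noBlock σ x b (e , freeᵁ b , inj₁ (inj₁ freeᵁ , inj₂ (a , inj₂ (refl , refl) , x⪰a)))
    where freeᵁ = Union.union-freeA G a b N x≢a free
  rivals-matched {N} σ (inj₂ (y , (y≢b , e , y⪰b) , free)) =
    noBlock σ a y (e , freeᵁ a , inj₂ (inj₁ freeᵁ , inj₂ (b , inj₂ (refl , refl) , y⪰b)))
    where freeᵁ = Union.union-freeB G a b N y≢b free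

  -- By rural hospitals in G', all strongly stable matchings of G' leave the same rivals unmatched.
  rivals-transfer : ∀ {M N} → StronglyStable G' M → StronglyStable G' N →
                    RivalUnmatched N → RivalUnmatched M
  rivals-transfer σM σN (inj₁ (x , rival , free)) =
    inj₁ (x , rival , unmatchedA-preserved σM σN x free)
  rivals-transfer σM σN (inj₂ (y , rival , free)) =
    inj₂ (y , rival , unmatchedB-preserved σM σN y free)

  module Extension (N : EdgeSet m n) (μ : IsMatching G' N) where
    open Union G a b N

    private
      keptN : ∀ {x y} → N x y → ¬ Removed G a b x y
      keptN {x} {y} xy = proj₂ (⊆E μ x y xy)

    prefA-at-a : ∀ _~_ {y} → PrefA _~_ G U a y → rA a y ~ rA a b
    prefA-at-a _~_ s with situationA _~_ s
    ... | inj₁ (_ , cmp)               = cmp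
    ... | inj₂ (inj₁ (a≢a , _))        = ⊥-elim (a≢a refl)
    ... | inj₂ (inj₂ (_ , ay' , _))    = ⊥-elim (proj₁ (kept-avoids (keptN ay')) refl)

    prefB-at-b : ∀ _~_ {x} → PrefA _~_ (G ᵀ) (flip U) b x → rB b x ~ rB b a
    prefB-at-b _~_ s with situationB _~_ s
    ... | inj₁ (_ , cmp)               = cmp
    ... | inj₂ (inj₁ (b≢b , _))        = ⊥-elim (b≢b refl)
    ... | inj₂ (inj₂ (_ , x'b , _))    = ⊥-elim (proj₂ (kept-avoids (keptN x'b)) refl)

    -- A man x adjacent to b with x ⪰_b a, whose preference for y in U is
    -- explained neither by x = a nor by an N-partner (every candidate partner
    -- would have been deleted), is an unmatched rival of a.
    rivalA-if : ∀ _~_ {x y} → edge G x b → rB b x ≤ rB b a →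
                (x ≡ a → ¬ (rA a y ~ rA a b)) →
                (∀ {y'} → N x y' → rA x y ~ rA x y' → Removed G a b x y') →
                PrefA _~_ G U x y → RivalUnmatched N
    rivalA-if _~_ e x⪰a not-a deleted s with situationA _~_ s
    ... | inj₁ (x≡a , cmp)            = ⊥-elim (not-a x≡a cmp)
    ... | inj₂ (inj₁ (x≢a , free))    = inj₁ (_ , (x≢a , e , x⪰a) , free)
    ... | inj₂ (inj₂ (_ , xy' , cmp)) = ⊥-elim (keptN xy' (deleted xy' cmp))

    rivalB-if : ∀ _~_ {x y} → edge G a y → rA a y ≤ rA a b →
                (y ≡ b → ¬ (rB b x ~ rB b a)) →
                (∀ {x'} → N x' y → rB y x ~ rB y x' → Removed G a b x' y) →
                PrefA _~_ (G ᵀ) (flip U) y x → RivalUnmatched N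
    rivalB-if _~_ e y⪰b not-b deleted s with situationB _~_ s
    ... | inj₁ (y≡b , cmp)            = ⊥-elim (not-b y≡b cmp)
    ... | inj₂ (inj₁ (y≢b , free))    = inj₂ (_ , (y≢b , e , y⪰b) , free)
    ... | inj₂ (inj₂ (_ , x'y , cmp)) = ⊥-elim (keptN x'y (deleted x'y cmp))

    -- A deleted edge blocking U exhibits an unmatched rival: rules (2) and (5)
    -- contradict the pairing of a with b, and in the other rules the partner
    -- that could excuse the blocking edge would itself have been deleted.
    removed-blocking : ∀ {x y} → Removed G a b x y → Blocks G U x y → RivalUnmatched N
    removed-blocking (r1 refl refl) (_ , ab∉U , _) = ⊥-elim (ab∉U (inj₂ (refl , refl)))
    removed-blocking (r2 refl a≻x) (_ , _ , envy) =
      ⊥-elim (<⇒≱ a≻x (prefB-at-b _≤_ (weakB-of envy)))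
    removed-blocking (r3 refl x=a) (_ , _ , inj₂ (s , _)) =
      ⊥-elim (<-irrefl x=a (prefB-at-b _<_ s))
    removed-blocking (r3 refl x=a) (e , _ , inj₁ (s , _)) =
      rivalA-if _<_ e (≤-reflexive x=a) (λ { refl → <-irrefl refl }) (λ _ → r3' e x=a) s
    removed-blocking (r3' e x=a b≻y) (_ , _ , envy) =
      rivalA-if _≤_ e (≤-reflexive x=a) (λ { refl → <⇒≱ b≻y })
                (λ _ → r3' e x=a ∘ <-≤-trans b≻y) (weakA-of envy)
    removed-blocking (r4 refl x≻a) (e , _ , envy) =
      rivalA-if _≤_ e (<⇒≤ x≻a) (λ { refl _ → <-irrefl refl x≻a })
                (λ _ → r4' e x≻a) (weakA-of envy)
    removed-blocking (r4' e x≻a b⪰y) (_ , _ , envy) =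
      rivalA-if _≤_ e (<⇒≤ x≻a) (λ { refl _ → <-irrefl refl x≻a })
                (λ _ → r4' e x≻a ∘ ≤-trans b⪰y) (weakA-of envy)
    removed-blocking (r5 refl b≻y) (_ , _ , envy) =
      ⊥-elim (<⇒≱ b≻y (prefA-at-a _≤_ (weakA-of envy)))
    removed-blocking (r6 refl y=b) (_ , _ , inj₁ (s , _)) =
      ⊥-elim (<-irrefl y=b (prefA-at-a _<_ s))
    removed-blocking (r6 refl y=b) (e , _ , inj₂ (s , _)) =
      rivalB-if _<_ e (≤-reflexive y=b) (λ { refl → <-irrefl refl }) (λ _ → r6' e y=b) s
    removed-blocking (r6' e y=b a≻x) (_ , _ , envy) =
      rivalB-if _≤_ e (≤-reflexive y=b) (λ { refl → <⇒≱ a≻x })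
                (λ _ → r6' e y=b ∘ <-≤-trans a≻x) (weakB-of envy)
    removed-blocking (r7 refl y≻b) (e , _ , envy) =
      rivalB-if _≤_ e (<⇒≤ y≻b) (λ { refl _ → <-irrefl refl y≻b })
                (λ _ → r7' e y≻b) (weakB-of envy)
    removed-blocking (r7' e y≻b a⪰x) (_ , _ , envy) =
      rivalB-if _≤_ e (<⇒≤ y≻b) (λ { refl _ → <-irrefl refl y≻b })
                (λ _ → r7' e y≻b ∘ ≤-trans a⪰x) (weakB-of envy)

    kept-blocking : ∀ {x y} → ¬ Removed G a b x y → Blocks G U x y → Blocks G' N x y
    kept-blocking kept (e , ∉U , envy) =
      (e , kept) , ∉U ∘ inj₁ ,
      envy-transfer {H = G} (union-agreesA (proj₁ (kept-avoids kept)))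
                                (union-agreesB (proj₂ (kept-avoids kept))) envy

    -- U is a matching of G, as N avoids a and b.
    union-matching : edge G a b → IsMatching G U
    union-matching ab∈E = record { ⊆E = ⊆U ; uniqA = uniqU ; uniqB = uniqUᵀ }
      where
      avoids : ∀ {x y} → N x y → x ≢ a × y ≢ b
      avoids = kept-avoids ∘ keptN
      ⊆U : ∀ x y → U x y → edge G x y
      ⊆U x y (inj₁ xy)           = proj₁ (⊆E μ x y xy)
      ⊆U x y (inj₂ (refl , refl)) = ab∈E
      uniqU : ∀ x y y' → U x y → U x y' → y ≡ y'
      uniqU x y y' (inj₁ p)        (inj₁ q)         = uniqA μ x y y' p q
      uniqU x y y' (inj₁ p)        (inj₂ (x≡a , _)) = ⊥-elim (proj₁ (avoids p) x≡a)
      uniqU x y y' (inj₂ (x≡a , _)) (inj₁ q)        = ⊥-elim (proj₁ (avoids q) x≡a)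
      uniqU x y y' (inj₂ (_ , p))  (inj₂ (_ , q))   = trans p (sym q)
      uniqUᵀ : ∀ x x' y → U x y → U x' y → x ≡ x'
      uniqUᵀ x x' y (inj₁ p)        (inj₁ q)         = uniqB μ x x' y p q
      uniqUᵀ x x' y (inj₁ p)        (inj₂ (_ , y≡b)) = ⊥-elim (proj₂ (avoids p) y≡b)
      uniqUᵀ x x' y (inj₂ (_ , y≡b)) (inj₁ q)        = ⊥-elim (proj₂ (avoids q) y≡b)
      uniqUᵀ x x' y (inj₂ (p , _))  (inj₂ (q , _))   = trans p (sym q)

  open Extension using (removed-blocking; kept-blocking; union-matching)

  extension-stable : ∀ {M' N} → edge G a b → StronglyStable G' M' →
                     StronglyStable G (M' ∪⟨ a , b ⟩) → StronglyStable G' N →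
                     StronglyStable G (N ∪⟨ a , b ⟩)
  extension-stable {M'} {N} ab∈E σM' σM'ab σN = record
    { matching = union-matching N (matching σN) ab∈E
    ; noBlock  = λ x y blocking → ¬¬-excluded-middle λ
        { (yes removed) → no-rival (removed-blocking N (matching σN) removed blocking)
        ; (no kept)     → noBlock σN x y (kept-blocking N (matching σN) kept blocking) } }
    where
    no-rival : ¬ RivalUnmatched N
    no-rival = rivals-matched σM'ab ∘ rivals-transfer σM' σN

  module Restriction (N : EdgeSet m n) (σ : StronglyStable G N) (ab∈N : N a b) where

    K : EdgeSet m n
    K x y = N x y × x ≢ a

    private
      partner-of-b : ∀ {x} → N x b → x ≡ a
      partner-of-b xb = uniqB (matching σ) _ a b xb ab∈N
      partner-of-a : ∀ {y} → N a y → y ≡ b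
      partner-of-a ay = uniqA (matching σ) a _ b ay ab∈N

    -- The other edges of N survive the construction; for the primed rules
    -- this is stability of N: otherwise (x,b) resp. (a,y) would block N.
    edges-kept : ∀ {x y} → N x y → x ≢ a → ¬ Removed G a b x y
    edges-kept _  x≢a (r1 x≡a _) = x≢a x≡a
    edges-kept xb x≢a (r2 refl _) = x≢a (partner-of-b xb)
    edges-kept xb x≢a (r3 refl _) = x≢a (partner-of-b xb)
    edges-kept xb x≢a (r4 refl _) = x≢a (partner-of-b xb)
    edges-kept _  x≢a (r5 x≡a _) = x≢a x≡a
    edges-kept _  x≢a (r6 x≡a _) = x≢a x≡a
    edges-kept _  x≢a (r7 x≡a _) = x≢a x≡a
    edges-kept {x} {y} xy x≢a (r3' e x=a b≻y) = noBlock σ x b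
      (e , x≢a ∘ partner-of-b , inj₁ (inj₂ (y , xy , b≻y) , inj₂ (a , ab∈N , ≤-reflexive x=a)))
    edges-kept {x} {y} xy x≢a (r4' e x≻a b⪰y) = noBlock σ x b
      (e , x≢a ∘ partner-of-b , inj₂ (inj₂ (a , ab∈N , x≻a) , inj₂ (y , xy , b⪰y)))
    edges-kept {x} {y} xy x≢a (r6' e y=b a≻x) = noBlock σ a y
      (e , ay∉N , inj₂ (inj₂ (x , xy , a≻x) , inj₂ (b , ab∈N , ≤-reflexive y=b)))
      where
      ay∉N : ¬ N a y
      ay∉N ay = x≢a (partner-of-b (subst (N x) (partner-of-a ay) xy))
    edges-kept {x} {y} xy x≢a (r7' e y≻b a⪰x) = noBlock σ a y
      (e , ay∉N , inj₁ (inj₂ (b , ab∈N , y≻b) , inj₂ (x , xy , a⪰x)))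
      where
      ay∉N : ¬ N a y
      ay∉N ay = x≢a (partner-of-b (subst (N x) (partner-of-a ay) xy))

    restriction-agreesA : ∀ {x} → x ≢ a → AgreeA K N x
    restriction-agreesA x≢a = record { to = λ _ → proj₁ ; from = λ _ → _, x≢a }

    restriction-agreesB : ∀ {y} → y ≢ b → AgreeB K N y
    restriction-agreesB y≢b = record
      { to = λ _ → proj₁ ; from = λ _ x'y → x'y , λ { refl → y≢b (partner-of-a x'y) } }

    -- K is strongly stable in G': a blocking edge of G' avoids a and b, where
    -- K and N agree, so it would block N in G.
    restriction-stable : StronglyStable G' K
    restriction-stable = record
      { matching = record
        { ⊆E    = λ x y (xy , x≢a) → ⊆E (matching σ) x y xy , edges-kept xy x≢a
        ; uniqA = λ x y y' p q → uniqA (matching σ) x y y' (proj₁ p) (proj₁ q)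
        ; uniqB = λ x x' y p q → uniqB (matching σ) x x' y (proj₁ p) (proj₁ q) }
      ; noBlock = λ x y ((e , kept) , ∉K , envy) →
          let (x≢a , y≢b) = kept-avoids kept in
          noBlock σ x y (e , (λ xy → ∉K (xy , x≢a)) ,
            envy-transfer {H = G} (restriction-agreesA x≢a) (restriction-agreesB y≢b) envy) }

    restriction-extends : StronglyStable G (K ∪⟨ a , b ⟩)
    restriction-extends = stable-resp N⊆KU KU⊆N σ
      where
      N⊆KU : ∀ x y → N x y → (K ∪⟨ a , b ⟩) x y
      N⊆KU x y xy with x ≟ a
      ... | yes refl = inj₂ (refl , partner-of-a xy)
      ... | no  x≢a  = inj₁ (xy , x≢a)
      KU⊆N : ∀ x y → (K ∪⟨ a , b ⟩) x y → N x y
      KU⊆N x y (inj₁ (xy , _))      = xy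
      KU⊆N x y (inj₂ (refl , refl)) = ab∈N

lemma3 : {m n : ℕ} (G : Instance m n) (a : Fin m) (b : Fin n) → edge G a b →
         (M' : EdgeSet m n) → StronglyStable (G[_,_] G a b) M' →
         (StronglyStable G (M' ∪⟨ a , b ⟩) →
            ∀ (N : EdgeSet m n) → StronglyStable (G[_,_] G a b) N →
              StronglyStable G (N ∪⟨ a , b ⟩))
         × (¬ StronglyStable G (M' ∪⟨ a , b ⟩) →
            ¬ (∃[ N ] (StronglyStable G N × N a b)))
lemma3 G a b ab∈E M' σM' =
  (λ σM'ab N σN → extension-stable ab∈E σM' σM'ab σN) ,
  λ { M'ab-unstable (N , σN , ab∈N) → let open Restriction N σN ab∈N in
        M'ab-unstable (extension-stable ab∈E restriction-stable restriction-extends σM') }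
  where
  open Construction G a b
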